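{- Let $x:\mathbb{N}_+\to\mathbb{N}$ be non-decreasing and $n\ge1$. In the $\mathbb{C}$-vector space with basis the maps $[n]\to\mathbb{N}_+$, $$\sum_{f\ x\text{ -parking function on }[n]} f\;=\;\sum_{B}(-1)^{d(B)}\sum_{\substack{q:[n]\to\mathbb{N}_+\\ q\le p_B}}q,$$ where $B=(B_1,\dots,B_k)$ ranges over ordered set partitions of $[n]$ into non-empty blocks, $d(B)=n-k$, $p_B:[n]\to\mathbb{N}$ is defined by $p_B(j)=x\big(1+|B_1|+\dots+|B_{m-1}|\big)$ for $j\in B_m$, and $q\le p_B$ means $q(j)\le p_B(j)$ for all $j\in[n]$.
   Context: A map $f:[n]\to\mathbb{N}_+$ is an $x$-parking function if $|f^{ -1}(\{1,\dots,x(k)\})|\ge k$ for all $1\le k\le n$. The functions $p_B$ are the paper's "primitive $x$-parking functions", labelling the faces of the polytope whose faces are indexed by ordered set partitions (a face with $k$ blocks having dimension $n-k$). -}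

module Defs where

open import Data.Nat using (ℕ; zero; suc; _≤_; _<_; _≤?_; _<?_; _∸_)
open import Data.Nat.Base as ℕ using ()
open import Data.Integer using (ℤ; +_; -_) renaming (_+_ to _+ℤ_; _*_ to _*ℤ_; _^_ to _^ℤ_)
open import Data.Fin using (Fin; toℕ; zero; suc)
open import Data.Fin.Properties using (all?; any?)
open import Data.List using (List; []; _∷_; _++_; map; length; filter; allFin; upTo; concatMap; foldr)
open import Data.Product using (_×_; ∃)
open import Data.Product.Properties using ()
open import Relation.Nullary using (Dec; yes; no; does)
open import Relation.Nullary.Decidable using (_×-dec_)
open import Relation.Binary.PropositionalEquality using (_≡_)
open import Data.Fin.Properties using () renaming (_≟_ to _≟F_)
open import Data.Bool using (if_then_else_)

#[_] : ∀ {n} {P : Fin n → Set} → (∀ j → Dec (P j)) → ℕ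
#[_] {n} P? = length (filter P? (allFin n))

-- x non-decreasing on ℕ₊ (x is given on all of ℕ, only its values at positive arguments are used)
NonDecreasing₊ : (ℕ → ℕ) → Set
NonDecreasing₊ x = ∀ {a b} → 1 ≤ a → a ≤ b → x a ≤ x b

-- g : [n] → ℕ₊ (a basis element of the vector space)
Positive : ∀ {n} → (Fin n → ℕ) → Set
Positive g = ∀ j → 1 ≤ g j

IsParking : (x : ℕ → ℕ) → ∀ {n} → (Fin n → ℕ) → Set
IsParking x {n} f =
  ∀ k → 1 ≤ k → k ≤ n → k ≤ #[ (λ j → (1 ≤? f j) ×-dec (f j ≤? x k)) ]

allMaps : (n k : ℕ) → List (Fin n → Fin k)
allMaps zero k = (λ ()) ∷ []
allMaps (suc n) k =
  concatMap (λ (i : Fin k) → map (λ (σ : Fin n → Fin k) → cons i σ) (allMaps n k)) (allFin k)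
  where
  cons : Fin k → (Fin n → Fin k) → Fin (suc n) → Fin k
  cons i σ zero = i
  cons i σ (suc j) = σ j

Surjective : ∀ {n k} → (Fin n → Fin k) → Set
Surjective {n} {k} σ = ∀ (m : Fin k) → ∃ λ (j : Fin n) → σ j ≡ m

surjective? : ∀ {n k} (σ : Fin n → Fin k) → Dec (Surjective σ)
surjective? σ = all? (λ m → any? (λ j → σ j ≟F m))

-- ordered set partitions B = (B₁,…,B_k) of [n] into non-empty blocks, encoded as
-- surjections σ : [n] → [k] (σ j = index of the block containing j)
OSP : (n k : ℕ) → List (Fin n → Fin k)
OSP n k = filter surjective? (allMaps n k)

blockSize : ∀ {n k} → (Fin n → Fin k) → Fin k → ℕ
blockSize σ m = #[ (λ j → σ j ≟F m) ]

sumBefore : ∀ {n k} → (Fin n → Fin k) → Fin k → ℕ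
sumBefore {n} {k} σ m =
  foldr ℕ._+_ 0 (map (blockSize σ) (filter (λ i → toℕ i <? toℕ m) (allFin k)))

p : (x : ℕ → ℕ) → ∀ {n k} → (Fin n → Fin k) → Fin n → ℕ
p x σ j = x (suc (sumBefore σ (σ j)))

sumℤ : List ℤ → ℤ
sumℤ = foldr _+ℤ_ (+ 0)

-- coefficient of the basis element g in  Σ_B (-1)^{d(B)} Σ_{q ≤ p_B} q ,  d(B) = n - k
rhsCoeff : (x : ℕ → ℕ) → (n : ℕ) → (Fin n → ℕ) → ℤ
rhsCoeff x n g =
  sumℤ (concatMap
    (λ k → map
      (λ (σ : Fin n → Fin k) →
        ((- (+ 1)) ^ℤ (n ∸ k)) *ℤ
          (if does (all? (λ j → g j ≤? p x σ j)) then + 1 else + 0))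
      (OSP n k))
    (map suc (upTo n)))

-- Encode B = (B₁,…,B_k) as the surjection σ : [n] → [k] sending j to the index of its block; then
-- p_B(j) = x(1 + #{i : σ i < σ j}) and the coefficient of g on the right is the alternating count
-- R_x(g) = ∑_k (-1)^(n-k) #{σ : [n] ↠ [k] with g ≤ p_σ}. Write σ = i ∷ τ with i the block of the first
-- element 0. Either 0 shares its block, and τ is a surjection onto the same blocks, or {0} is a block,
-- and τ = punchIn i ∘ τ′ with τ′ a surjection onto one block fewer. For a fixed surjection τ onto m
-- blocks, compare the m + 1 ways of inserting {0} as a new block with the m ways of adding 0 to a block
-- of τ: whether g ≤ p_σ holds at 0 is monotone in the position i, and at the first position where it
-- holds, the condition on the other elements is g ∘ suc ≤ p_τ for the shifted sequence
-- x′(t) = x(t+1) if g(0) ≤ x(t), x′(t) = x(t) otherwise. The two sums telescope to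
-- [g(0) ≤ x(n)]·[g ∘ suc ≤ p_τ for x′], and as they carry opposite signs,
-- R_x(g) = [g(0) ≤ x(n)] · R_x′(g ∘ suc). Parking functions obey the same recursion (g is x-parking
-- iff g(0) ≤ x(n) and g ∘ suc is x′-parking), and for n = 1 both sides are [g(0) ≤ x(1)].

module Submission where

open import Defs
open import Data.Nat using (ℕ; _≤_)
open import Data.Fin using (Fin)
open import Data.Integer using (ℤ; +_)
open import Data.Product using (_×_)
open import Relation.Nullary using (¬_)
open import Relation.Binary.PropositionalEquality using (_≡_)

open import Algebra.Properties.Semiring.Sum as SemiringSum using ()
open import Data.Bool using (Bool; true; false; _∧_; if_then_else_; T)
open import Data.Bool.Properties using (T-∧)
open import Data.Empty using (⊥-elim)
open import Data.Fin using (zero; suc; toℕ; punchIn; punchOut; _≟_)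
open import Data.Fin.Properties using (all?)
import Data.Fin.Properties as Fin
open import Data.Integer using (-_; _+_; _*_; _^_)
import Data.Integer.Properties as ℤ
open import Data.Integer.Tactic.RingSolver using (solve-∀)
open import Data.List as List using (List; _++_; filter; allFin; upTo; concatMap; applyUpTo; tabulate; length)
open import Data.List.Properties using (map-concatMap; map-∘; map-cong)
open import Data.Nat using (zero; suc; z≤n; s≤s; _<_; _∸_; _≤ᵇ_; _<ᵇ_; _≤?_; _<?_)
  renaming (_+_ to _+ℕ_; _*_ to _*ℕ_)
open import Data.Nat.ListAction using () renaming (sum to sumℕ)
import Data.Nat.Properties as ℕ
open import Data.Product using (∃; _,_; proj₁; proj₂)
open import Data.Vec.Functional using (_∷_)
open import Function using (_∘_; _⇔_; mk⇔; Equivalence)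
open import Relation.Binary.PropositionalEquality
  using (refl; sym; trans; cong; cong₂; subst; _≢_; _≗_; module ≡-Reasoning)
open import Relation.Nullary using (Dec; yes; no; does; ¬?)
open import Relation.Nullary.Decidable using (does-⇔; dec-true; dec-false; decidable-stable; _×-dec_)
open import Relation.Unary using (Pred; Decidable)

module ℤΣ = SemiringSum ℤ.+-*-semiring
module ℕΣ = SemiringSum ℕ.+-*-semiring
open ℤΣ using (sum-syntax)

𝟙 : Bool → ℕ
𝟙 true = 1
𝟙 false = 0

⟦_⟧ : Bool → ℤ
⟦ b ⟧ = + 𝟙 b

⟦∧⟧ : ∀ a b → ⟦ a ∧ b ⟧ ≡ ⟦ a ⟧ * ⟦ b ⟧
⟦∧⟧ false b = refl
⟦∧⟧ true b = sym (ℤ.*-identityˡ ⟦ b ⟧)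

indicator-split : ∀ {a b c} {A : Set a} {S : Set b} {S′ : Set c} (A? : Dec A) (S? : Dec S) (S′? : Dec S′) →
  (A → ¬ S′) → (¬ A → S ⇔ S′) → ⟦ does S? ⟧ ≡ ⟦ does S′? ⟧ + ⟦ does A? ⟧ * ⟦ does S? ⟧
indicator-split (yes a) S? S′? a⇒¬S′ _ rewrite dec-false S′? (a⇒¬S′ a) =
  sym (trans (ℤ.+-identityˡ (+ 1 * ⟦ does S? ⟧)) (ℤ.*-identityˡ ⟦ does S? ⟧))
indicator-split (no ¬a) S? S′? _ ¬a⇒S⇔S′ rewrite does-⇔ (¬a⇒S⇔S′ ¬a) S? S′? =
  sym (trans (cong (_+_ ⟦ does S′? ⟧) (ℤ.*-zeroˡ ⟦ does S′? ⟧)) (ℤ.+-identityʳ ⟦ does S′? ⟧))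

count : ∀ {n} → (Fin n → Bool) → ℕ
count f = ℕΣ.sum (𝟙 ∘ f)

count-cong : ∀ {n} {f h : Fin n → Bool} → f ≗ h → count f ≡ count h
count-cong f≗h = ℕΣ.sum-cong-≗ (cong 𝟙 ∘ f≗h)

count-mono : ∀ {n} {f h : Fin n → Bool} → (∀ j → T (f j) → T (h j)) → count f ≤ count h
count-mono {zero} f⇒h = z≤n
count-mono {suc n} f⇒h = ℕ.+-mono-≤ (𝟙-mono (f⇒h zero)) (count-mono (f⇒h ∘ suc))
  where
  𝟙-mono : ∀ {a b} → (T a → T b) → 𝟙 a ≤ 𝟙 b
  𝟙-mono {false} _ = z≤n
  𝟙-mono {true} {true} _ = s≤s z≤n
  𝟙-mono {true} {false} a⇒b = ⊥-elim (a⇒b _)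

count-all : ∀ {n} {f : Fin n → Bool} → (∀ j → T (f j)) → count f ≡ n
count-all {zero} _ = refl
count-all {suc n} {f} all-f with f zero | all-f zero
... | true | _ = cong suc (count-all (all-f ∘ suc))

count≤n : ∀ {n} (f : Fin n → Bool) → count f ≤ n
count≤n f = subst (count f ≤_) (count-all {f = λ _ → true} _) (count-mono {f = f} {h = λ _ → true} (λ _ _ → _))

does-all?-cong : ∀ {n p q} {P : Pred (Fin n) p} {Q : Pred (Fin n) q} (P? : Decidable P) (Q? : Decidable Q) →
  (∀ j → does (P? j) ≡ does (Q? j)) → does (all? P?) ≡ does (all? Q?)
does-all?-cong {zero} P? Q? same = refl
does-all?-cong {suc n} P? Q? same = cong₂ _∧_ (same zero) (does-all?-cong (P? ∘ suc) (Q? ∘ suc) (same ∘ suc))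

∑-select : ∀ {k} (a : Fin k) (B : Fin k → ℕ) → ℕΣ.sum (λ i → B i *ℕ 𝟙 (does (a ≟ i))) ≡ B a
∑-select {suc k} zero B = begin
  B zero *ℕ 1 +ℕ ℕΣ.sum (λ i → B (suc i) *ℕ 0)
    ≡⟨ cong₂ _+ℕ_ (ℕ.*-identityʳ (B zero)) (ℕΣ.sum-cong-≗ {k} (ℕ.*-zeroʳ ∘ B ∘ suc)) ⟩
  B zero +ℕ ℕΣ.sum {k} (λ _ → 0)
    ≡⟨ cong (B zero +ℕ_) (ℕΣ.sum-replicate-zero k) ⟩
  B zero +ℕ 0
    ≡⟨ ℕ.+-identityʳ (B zero) ⟩
  B zero ∎
  where open ≡-Reasoning
∑-select {suc k} (suc a) B = cong₂ _+ℕ_ (ℕ.*-zeroʳ (B zero)) (∑-select a (B ∘ suc))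

∑-toℕ-init-last : ∀ k (h : ℕ → ℤ) → ∑[ t < suc k ] h (toℕ t) ≡ ∑[ t < k ] h (toℕ t) + h k
∑-toℕ-init-last k h =
  trans (ℤΣ.sum-init-last {k} (h ∘ toℕ))
        (cong₂ _+_ (ℤΣ.sum-cong-≗ {k} (cong h ∘ Fin.toℕ-inject₁)) (cong h (Fin.toℕ-fromℕ k)))

∑-punchIn : ∀ {k} (i : Fin (suc k)) (K : Fin (suc k) → ℤ) →
  ∑[ a < suc k ] (⟦ does (¬? (a ≟ i)) ⟧ * K a) ≡ ∑[ b < k ] K (punchIn i b)
∑-punchIn {k} zero K = trans (ℤ.+-identityˡ _) (ℤΣ.sum-cong-≗ {k} (ℤ.*-identityˡ ∘ K ∘ suc))
∑-punchIn {suc k} (suc i) K = cong₂ _+_ (ℤ.*-identityˡ (K zero)) (∑-punchIn i (K ∘ suc))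

telescope-step : ∀ a a′ e b → (T a → T a′) → (¬ T a → T a′ → e ≡ b) →
  ⟦ a ⟧ * ⟦ b ⟧ + ⟦ a′ ∧ e ⟧ ≡ ⟦ a ∧ e ⟧ + ⟦ a′ ⟧ * ⟦ b ⟧
telescope-step true true false false _ _ = refl
telescope-step true true false true _ _ = refl
telescope-step true true true false _ _ = refl
telescope-step true true true true _ _ = refl
telescope-step true false _ _ a⇒a′ _ = ⊥-elim (a⇒a′ _)
telescope-step false true e b _ e≡b with refl ← e≡b (λ ()) _ | e
... | false = refl
... | true = refl
telescope-step false false _ _ _ _ = refl

telescope : (A E : ℕ → Bool) (b : Bool) → (∀ t → T (A t) → T (A (suc t))) →
  (T (A 0) → E 0 ≡ b) → (∀ t → ¬ T (A t) → T (A (suc t)) → E (suc t) ≡ b) →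
  ∀ k → ∑[ t < suc k ] ⟦ A (toℕ t) ∧ E (toℕ t) ⟧
        ≡ ∑[ t < k ] ⟦ A (toℕ t) ∧ E (suc (toℕ t)) ⟧ + ⟦ A k ⟧ * ⟦ b ⟧
telescope A E b A-mono E₀ E-jump zero with A 0 | E 0 | E₀
... | false | _ | _ = refl
... | true | false | E₀≡b with refl ← E₀≡b _ = refl
... | true | true | E₀≡b with refl ← E₀≡b _ = refl
telescope A E b A-mono E₀ E-jump (suc k) = begin
  ∑[ t < suc (suc k) ] ⟦ A (toℕ t) ∧ E (toℕ t) ⟧
    ≡⟨ ∑-toℕ-init-last (suc k) (λ t → ⟦ A t ∧ E t ⟧) ⟩
  ∑[ t < suc k ] ⟦ A (toℕ t) ∧ E (toℕ t) ⟧ + ⟦ A (suc k) ∧ E (suc k) ⟧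
    ≡⟨ cong (_+ ⟦ A (suc k) ∧ E (suc k) ⟧) (telescope A E b A-mono E₀ E-jump k) ⟩
  Jumps k + ⟦ A k ⟧ * ⟦ b ⟧ + ⟦ A (suc k) ∧ E (suc k) ⟧
    ≡⟨ ℤ.+-assoc (Jumps k) _ _ ⟩
  Jumps k + (⟦ A k ⟧ * ⟦ b ⟧ + ⟦ A (suc k) ∧ E (suc k) ⟧)
    ≡⟨ cong (_+_ (Jumps k)) (telescope-step (A k) (A (suc k)) (E (suc k)) b (A-mono k) (E-jump k)) ⟩
  Jumps k + (⟦ A k ∧ E (suc k) ⟧ + ⟦ A (suc k) ⟧ * ⟦ b ⟧)
    ≡⟨ ℤ.+-assoc (Jumps k) _ _ ⟨
  Jumps k + ⟦ A k ∧ E (suc k) ⟧ + ⟦ A (suc k) ⟧ * ⟦ b ⟧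
    ≡⟨ cong (_+ ⟦ A (suc k) ⟧ * ⟦ b ⟧) (∑-toℕ-init-last k (λ t → ⟦ A t ∧ E (suc t) ⟧)) ⟨
  Jumps (suc k) + ⟦ A (suc k) ⟧ * ⟦ b ⟧ ∎
  where
  open ≡-Reasoning
  Jumps : ℕ → ℤ
  Jumps m = ∑[ t < m ] ⟦ A (toℕ t) ∧ E (suc (toℕ t)) ⟧

∑ᴹ : ∀ {n k} → ((Fin n → Fin k) → ℤ) → ℤ
∑ᴹ {zero} F = F (λ ())
∑ᴹ {suc n} {k} F = ∑[ i < k ] ∑ᴹ (λ τ → F (i ∷ τ))

-- Without function extensionality, summands over maps have to be shown to respect pointwise equality.
Extensional : ∀ {n k} → ((Fin n → Fin k) → ℤ) → Set
Extensional F = ∀ {σ σ′} → σ ≗ σ′ → F σ ≡ F σ′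

∷-cong : ∀ {a} {A : Set a} {m} (y : A) {τ τ′ : Fin m → A} → τ ≗ τ′ → (y ∷ τ) ≗ (y ∷ τ′)
∷-cong y τ≗τ′ zero = refl
∷-cong y τ≗τ′ (suc j) = τ≗τ′ j

∑ᴹ-cong : ∀ {n k} {F G : (Fin n → Fin k) → ℤ} → (∀ σ → F σ ≡ G σ) → ∑ᴹ F ≡ ∑ᴹ G
∑ᴹ-cong {zero} F≗G = F≗G _
∑ᴹ-cong {suc n} {k} F≗G = ℤΣ.sum-cong-≗ {k} (λ i → ∑ᴹ-cong (λ τ → F≗G (i ∷ τ)))

∑ᴹ-distrib-+ : ∀ {n k} (F G : (Fin n → Fin k) → ℤ) → ∑ᴹ (λ σ → F σ + G σ) ≡ ∑ᴹ F + ∑ᴹ G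
∑ᴹ-distrib-+ {zero} F G = refl
∑ᴹ-distrib-+ {suc n} {k} F G =
  trans (ℤΣ.sum-cong-≗ {k} (λ i → ∑ᴹ-distrib-+ (λ τ → F (i ∷ τ)) (λ τ → G (i ∷ τ))))
        (ℤΣ.∑-distrib-+ (λ i → ∑ᴹ (λ τ → F (i ∷ τ))) (λ i → ∑ᴹ (λ τ → G (i ∷ τ))))

*-distribˡ-∑ᴹ : ∀ {n k} (c : ℤ) (F : (Fin n → Fin k) → ℤ) → c * ∑ᴹ F ≡ ∑ᴹ (λ σ → c * F σ)
*-distribˡ-∑ᴹ {zero} c F = refl
*-distribˡ-∑ᴹ {suc n} {k} c F =
  trans (ℤΣ.*-distribˡ-sum c (λ i → ∑ᴹ (λ τ → F (i ∷ τ))))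
        (ℤΣ.sum-cong-≗ {k} (λ i → *-distribˡ-∑ᴹ c (λ τ → F (i ∷ τ))))

∑-∑ᴹ-comm : ∀ {m n k} (F : Fin m → (Fin n → Fin k) → ℤ) →
  ∑[ i < m ] ∑ᴹ (F i) ≡ ∑ᴹ (λ σ → ∑[ i < m ] F i σ)
∑-∑ᴹ-comm {n = zero} F = refl
∑-∑ᴹ-comm {n = suc n} {k} F =
  trans (ℤΣ.∑-comm (λ i a → ∑ᴹ (λ τ → F i (a ∷ τ))))
        (ℤΣ.sum-cong-≗ {k} (λ a → ∑-∑ᴹ-comm (λ i τ → F i (a ∷ τ))))

Avoids : ∀ {n k} → Fin k → (Fin n → Fin k) → Set
Avoids i τ = ∀ j → τ j ≢ i

avoids? : ∀ {n k} (i : Fin k) (τ : Fin n → Fin k) → Dec (Avoids i τ)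
avoids? i τ = all? (λ j → ¬? (τ j ≟ i))

∑ᴹ-avoiding : ∀ {n k} (i : Fin (suc k)) (H : (Fin n → Fin (suc k)) → ℤ) → Extensional H →
  ∑ᴹ (λ τ → ⟦ does (avoids? i τ) ⟧ * H τ) ≡ ∑ᴹ (λ τ → H (punchIn i ∘ τ))
∑ᴹ-avoiding {zero} i H H-ext = trans (ℤ.*-identityˡ _) (H-ext (λ ()))
∑ᴹ-avoiding {suc n} {k} i H H-ext = begin
  ∑[ a < suc k ] ∑ᴹ (λ τ → ⟦ does (¬? (a ≟ i)) ∧ does (avoids? i τ) ⟧ * H (a ∷ τ))
    ≡⟨ ℤΣ.sum-cong-≗ {suc k} (λ a → trans (∑ᴹ-cong (reassoc a))
                                           (sym (*-distribˡ-∑ᴹ (≢i a) (avoiding a)))) ⟩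
  ∑[ a < suc k ] (≢i a * ∑ᴹ (avoiding a))
    ≡⟨ ℤΣ.sum-cong-≗ {suc k} (λ a → cong (≢i a *_)
                                          (∑ᴹ-avoiding i (λ τ → H (a ∷ τ)) (H-ext ∘ ∷-cong a))) ⟩
  ∑[ a < suc k ] (≢i a * ∑ᴹ (λ τ → H (a ∷ punchIn i ∘ τ)))
    ≡⟨ ∑-punchIn i (λ a → ∑ᴹ (λ τ → H (a ∷ punchIn i ∘ τ))) ⟩
  ∑[ b < k ] ∑ᴹ (λ τ → H (punchIn i b ∷ punchIn i ∘ τ))
    ≡⟨ ℤΣ.sum-cong-≗ {k} (λ b → ∑ᴹ-cong (λ τ → H-ext (punchIn-∷ b τ))) ⟩
  ∑[ b < k ] ∑ᴹ (λ τ → H (punchIn i ∘ (b ∷ τ))) ∎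
  where
  open ≡-Reasoning
  ≢i : Fin (suc k) → ℤ
  ≢i a = ⟦ does (¬? (a ≟ i)) ⟧
  avoiding : Fin (suc k) → (Fin n → Fin (suc k)) → ℤ
  avoiding a τ = ⟦ does (avoids? i τ) ⟧ * H (a ∷ τ)
  reassoc : ∀ a τ → ⟦ does (¬? (a ≟ i)) ∧ does (avoids? i τ) ⟧ * H (a ∷ τ) ≡ ≢i a * avoiding a τ
  reassoc a τ = trans (cong (_* H (a ∷ τ)) (⟦∧⟧ (does (¬? (a ≟ i))) (does (avoids? i τ))))
                      (ℤ.*-assoc (≢i a) ⟦ does (avoids? i τ) ⟧ (H (a ∷ τ)))
  punchIn-∷ : ∀ b τ → (punchIn i b ∷ punchIn i ∘ τ) ≗ punchIn i ∘ (b ∷ τ)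
  punchIn-∷ b τ zero = refl
  punchIn-∷ b τ (suc j) = refl

length-filter-tabulate : ∀ {a p} {A : Set a} {P : Pred A p} (P? : Decidable P) {n} (f : Fin n → A) →
  length (filter P? (tabulate f)) ≡ count (does ∘ P? ∘ f)
length-filter-tabulate P? {zero} f = refl
length-filter-tabulate P? {suc n} f with does (P? (f zero))
... | true = cong suc (length-filter-tabulate P? (f ∘ suc))
... | false = length-filter-tabulate P? (f ∘ suc)

#[]≡count : ∀ {n} {P : Pred (Fin n) _} (P? : Decidable P) → #[ P? ] ≡ count (does ∘ P?)
#[]≡count P? = length-filter-tabulate P? (λ j → j)

sumℕ-map-filter-tabulate : ∀ {a p} {A : Set a} {P : Pred A p} (P? : Decidable P) (h : A → ℕ) {n} (f : Fin n → A) →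
  sumℕ (List.map h (filter P? (tabulate f))) ≡ ℕΣ.sum (λ i → 𝟙 (does (P? (f i))) *ℕ h (f i))
sumℕ-map-filter-tabulate P? h {zero} f = refl
sumℕ-map-filter-tabulate P? h {suc n} f with does (P? (f zero))
... | true = cong₂ _+ℕ_ (sym (ℕ.+-identityʳ (h (f zero)))) (sumℕ-map-filter-tabulate P? h (f ∘ suc))
... | false = sumℕ-map-filter-tabulate P? h (f ∘ suc)

sumℤ-++ : ∀ xs ys → sumℤ (xs ++ ys) ≡ sumℤ xs + sumℤ ys
sumℤ-++ List.[] ys = sym (ℤ.+-identityˡ (sumℤ ys))
sumℤ-++ (x List.∷ xs) ys = trans (cong (_+_ x) (sumℤ-++ xs ys)) (sym (ℤ.+-assoc x (sumℤ xs) (sumℤ ys)))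

sumℤ-concatMap : ∀ {a} {A : Set a} (f : A → List ℤ) xs → sumℤ (concatMap f xs) ≡ sumℤ (List.map (sumℤ ∘ f) xs)
sumℤ-concatMap f List.[] = refl
sumℤ-concatMap f (x List.∷ xs) = trans (sumℤ-++ (f x) _) (cong (_+_ (sumℤ (f x))) (sumℤ-concatMap f xs))

sumℤ-map-filter : ∀ {a p} {A : Set a} {P : Pred A p} (P? : Decidable P) (F : A → ℤ) xs →
  sumℤ (List.map F (filter P? xs)) ≡ sumℤ (List.map (λ a → ⟦ does (P? a) ⟧ * F a) xs)
sumℤ-map-filter P? F List.[] = refl
sumℤ-map-filter P? F (x List.∷ xs) with does (P? x)
... | true = cong₂ _+_ (sym (ℤ.*-identityˡ (F x))) (sumℤ-map-filter P? F xs)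
... | false = trans (sumℤ-map-filter P? F xs) (sym (ℤ.+-identityˡ _))

sumℤ-map-tabulate : ∀ {a} {A : Set a} (F : A → ℤ) {n} (f : Fin n → A) →
  sumℤ (List.map F (tabulate f)) ≡ ∑[ i < n ] F (f i)
sumℤ-map-tabulate F {zero} f = refl
sumℤ-map-tabulate F {suc n} f = cong (_+_ (F (f zero))) (sumℤ-map-tabulate F (f ∘ suc))

sumℤ-map-applyUpTo : ∀ {a} {A : Set a} (F : A → ℤ) (f : ℕ → A) n →
  sumℤ (List.map F (applyUpTo f n)) ≡ ∑[ k < n ] F (f (toℕ k))
sumℤ-map-applyUpTo F f zero = refl
sumℤ-map-applyUpTo F f (suc n) = cong (_+_ (F (f 0))) (sumℤ-map-applyUpTo F (f ∘ suc) n)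

sumℤ-concatMap-consing : ∀ {n k} (F : (Fin (suc n) → Fin k) → ℤ) → Extensional F →
  (c : Fin k → (Fin n → Fin k) → Fin (suc n) → Fin k) → (∀ i τ → c i τ ≗ i ∷ τ) →
  (τs : List (Fin n → Fin k)) →
  sumℤ (List.map F (concatMap (λ i → List.map (c i) τs) (allFin k)))
    ≡ ∑[ i < k ] sumℤ (List.map (λ τ → F (i ∷ τ)) τs)
sumℤ-concatMap-consing {k = k} F F-ext c c≗∷ τs = begin
  sumℤ (List.map F (concatMap (λ i → List.map (c i) τs) (allFin k)))
    ≡⟨ cong sumℤ (map-concatMap F (λ i → List.map (c i) τs) (allFin k)) ⟩
  sumℤ (concatMap (λ i → List.map F (List.map (c i) τs)) (allFin k))
    ≡⟨ sumℤ-concatMap (λ i → List.map F (List.map (c i) τs)) (allFin k) ⟩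
  sumℤ (List.map (λ i → sumℤ (List.map F (List.map (c i) τs))) (allFin k))
    ≡⟨ sumℤ-map-tabulate (λ i → sumℤ (List.map F (List.map (c i) τs))) (λ i → i) ⟩
  ∑[ i < k ] sumℤ (List.map F (List.map (c i) τs))
    ≡⟨ ℤΣ.sum-cong-≗ {k} (λ i → cong sumℤ (sym (map-∘ τs))) ⟩
  ∑[ i < k ] sumℤ (List.map (F ∘ c i) τs)
    ≡⟨ ℤΣ.sum-cong-≗ {k} (λ i → cong sumℤ (map-cong (λ τ → F-ext (c≗∷ i τ)) τs)) ⟩
  ∑[ i < k ] sumℤ (List.map (λ τ → F (i ∷ τ)) τs) ∎
  where open ≡-Reasoning

sumℤ-allMaps : ∀ {n k} (F : (Fin n → Fin k) → ℤ) → Extensional F → sumℤ (List.map F (allMaps n k)) ≡ ∑ᴹ F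
sumℤ-allMaps {zero} F F-ext = trans (ℤ.+-identityʳ _) (F-ext (λ ()))
sumℤ-allMaps {suc n} {k} F F-ext =
  trans (sumℤ-concatMap-consing F F-ext _ (λ i τ → λ { zero → refl ; (suc j) → refl }) (allMaps n k))
        (ℤΣ.sum-cong-≗ {k} λ i →
          sumℤ-allMaps (λ τ → F (i ∷ τ)) (λ τ≗τ′ → F-ext λ { zero → refl ; (suc j) → τ≗τ′ j }))

avoids⇒¬surjective : ∀ {n k} {i : Fin k} {τ : Fin n → Fin k} → Avoids i τ → ¬ Surjective τ
avoids⇒¬surjective τ-avoids-i τ-surj = τ-avoids-i (proj₁ (τ-surj _)) (proj₂ (τ-surj _))

surjective-∷⇔ : ∀ {n k} {i : Fin k} {τ : Fin n → Fin k} → ¬ Avoids i τ → Surjective (i ∷ τ) ⇔ Surjective τ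
surjective-∷⇔ {n} {i = i} {τ} ¬avoids = mk⇔ drop-head (λ τ-surj m → suc (proj₁ (τ-surj m)) , proj₂ (τ-surj m))
  where
  hit : ∃ λ j → τ j ≡ i
  hit with j , ¬τj≢i ← Fin.¬∀⟶∃¬ n _ (λ j → ¬? (τ j ≟ i)) ¬avoids =
    j , decidable-stable (τ j ≟ i) ¬τj≢i
  drop-head : Surjective (i ∷ τ) → Surjective τ
  drop-head surj m with surj m
  ... | zero , i≡m = proj₁ hit , trans (proj₂ hit) i≡m
  ... | suc j , τj≡m = j , τj≡m

surjective-∷-punchIn⇔ : ∀ {n k} {i : Fin (suc k)} {τ : Fin n → Fin k} →
  Surjective (i ∷ punchIn i ∘ τ) ⇔ Surjective τ
surjective-∷-punchIn⇔ {i = i} {τ} = mk⇔ to from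
  where
  to : Surjective (i ∷ punchIn i ∘ τ) → Surjective τ
  to surj m with surj (punchIn i m)
  ... | zero , i≡punchIn = ⊥-elim (Fin.punchInᵢ≢i i m (sym i≡punchIn))
  ... | suc j , eq = j , Fin.punchIn-injective i (τ j) m eq
  from : Surjective τ → Surjective (i ∷ punchIn i ∘ τ)
  from surj m with i ≟ m
  ... | yes i≡m = zero , i≡m
  ... | no i≢m with j , τj≡ ← surj (punchOut i≢m) = suc j , trans (cong (punchIn i) τj≡) (Fin.punchIn-punchOut i≢m)

¬surjective-into-larger : ∀ {n} (τ : Fin n → Fin (suc n)) → ¬ Surjective τ
¬surjective-into-larger {n} τ surj with a , b , a<b , same ← Fin.pigeonhole (ℕ.n<1+n n) (proj₁ ∘ surj) =
  ℕ.<-irrefl (cong toℕ (trans (sym (proj₂ (surj a))) (trans (cong τ same) (proj₂ (surj b))))) a<b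

⟦surjective⟧ : ∀ {n k} → (Fin n → Fin k) → ℤ
⟦surjective⟧ σ = ⟦ does (surjective? σ) ⟧

surjective-∷-split : ∀ {n k} (i : Fin k) (τ : Fin n → Fin k) →
  ⟦surjective⟧ (i ∷ τ) ≡ ⟦surjective⟧ τ + ⟦ does (avoids? i τ) ⟧ * ⟦surjective⟧ (i ∷ τ)
surjective-∷-split i τ =
  indicator-split (avoids? i τ) (surjective? (i ∷ τ)) (surjective? τ) avoids⇒¬surjective surjective-∷⇔

surjective?-cong : ∀ {n k} {σ σ′ : Fin n → Fin k} → σ ≗ σ′ → does (surjective? σ) ≡ does (surjective? σ′)
surjective?-cong σ≗σ′ =
  does-⇔ (mk⇔ (transport σ≗σ′) (transport (sym ∘ σ≗σ′))) (surjective? _) (surjective? _)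
  where
  transport : ∀ {σ σ′} → σ ≗ σ′ → Surjective σ → Surjective σ′
  transport σ≗σ′ surj m = proj₁ (surj m) , trans (sym (σ≗σ′ _)) (proj₂ (surj m))

-- Block sizes and the domination g ≤ p_σ

punchIn<ᵇi : ∀ {k} (i : Fin (suc k)) (b : Fin k) → (toℕ (punchIn i b) <ᵇ toℕ i) ≡ (toℕ b <ᵇ toℕ i)
punchIn<ᵇi zero b = refl
punchIn<ᵇi (suc i) zero = refl
punchIn<ᵇi (suc i) (suc b) = punchIn<ᵇi i b

i<ᵇpunchIn : ∀ {k} (i : Fin (suc k)) (b : Fin k) → (toℕ i <ᵇ toℕ (punchIn i b)) ≡ (toℕ i ≤ᵇ toℕ b)
i<ᵇpunchIn zero b = refl
i<ᵇpunchIn (suc i) zero = refl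
i<ᵇpunchIn (suc i) (suc b) = trans (i<ᵇpunchIn i b) (sym (<ᵇ-suc (toℕ i) (toℕ b)))
  where
  <ᵇ-suc : ∀ m n → (m <ᵇ suc n) ≡ (m ≤ᵇ n)
  <ᵇ-suc zero n = refl
  <ᵇ-suc (suc m) n = refl

punchIn<ᵇpunchIn : ∀ {k} (i : Fin (suc k)) (a b : Fin k) →
  (toℕ (punchIn i a) <ᵇ toℕ (punchIn i b)) ≡ (toℕ a <ᵇ toℕ b)
punchIn<ᵇpunchIn zero a b = refl
punchIn<ᵇpunchIn (suc i) zero zero = refl
punchIn<ᵇpunchIn (suc i) zero (suc b) = refl
punchIn<ᵇpunchIn (suc i) (suc a) zero = refl
punchIn<ᵇpunchIn (suc i) (suc a) (suc b) = punchIn<ᵇpunchIn i a b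

sizeBelow : ∀ {n k} → (Fin n → Fin k) → ℕ → ℕ
sizeBelow σ t = count (λ j → toℕ (σ j) <ᵇ t)

sizeBelow-mono : ∀ {n k} (σ : Fin n → Fin k) {s t} → s ≤ t → sizeBelow σ s ≤ sizeBelow σ t
sizeBelow-mono σ {s} {t} s≤t = count-mono {f = λ j → toℕ (σ j) <ᵇ s} {h = λ j → toℕ (σ j) <ᵇ t}
  (λ j σj<s → ℕ.<⇒<ᵇ (ℕ.<-≤-trans (ℕ.<ᵇ⇒< _ _ σj<s) s≤t))

sumBefore≡sizeBelow : ∀ {n k} (σ : Fin n → Fin k) (m : Fin k) → sumBefore σ m ≡ sizeBelow σ (toℕ m)
sumBefore≡sizeBelow {n} {k} σ m = begin
  sumBefore σ m
    ≡⟨ sumℕ-map-filter-tabulate (λ i → toℕ i <? toℕ m) (blockSize σ) (λ i → i) ⟩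
  ℕΣ.sum (λ i → [ i ] *ℕ blockSize σ i)
    ≡⟨ ℕΣ.sum-cong-≗ {k} (λ i → cong ([ i ] *ℕ_) (#[]≡count (λ j → σ j ≟ i))) ⟩
  ℕΣ.sum (λ i → [ i ] *ℕ ℕΣ.sum (λ j → 𝟙 (does (σ j ≟ i))))
    ≡⟨ ℕΣ.sum-cong-≗ {k} (λ i → ℕΣ.*-distribˡ-sum [ i ] (λ j → 𝟙 (does (σ j ≟ i)))) ⟩
  ℕΣ.sum (λ i → ℕΣ.sum (λ j → [ i ] *ℕ 𝟙 (does (σ j ≟ i))))
    ≡⟨ ℕΣ.∑-comm (λ i j → [ i ] *ℕ 𝟙 (does (σ j ≟ i))) ⟩
  ℕΣ.sum (λ j → ℕΣ.sum (λ i → [ i ] *ℕ 𝟙 (does (σ j ≟ i))))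
    ≡⟨ ℕΣ.sum-cong-≗ {n} (λ j → ∑-select (σ j) [_]) ⟩
  sizeBelow σ (toℕ m) ∎
  where
  open ≡-Reasoning
  [_] : Fin k → ℕ
  [ i ] = 𝟙 (toℕ i <ᵇ toℕ m)

dominated? : (x : ℕ → ℕ) → ∀ {n k} (g : Fin n → ℕ) (σ : Fin n → Fin k) → Dec (∀ j → g j ≤ p x σ j)
dominated? x g σ = all? (λ j → g j ≤? p x σ j)

⟦dominated⟧ : (x : ℕ → ℕ) → ∀ {n k} (g : Fin n → ℕ) (σ : Fin n → Fin k) → ℤ
⟦dominated⟧ x g σ = ⟦ does (dominated? x g σ) ⟧

dominated?-sizeBelow : ∀ x {n k} (g : Fin n → ℕ) (σ : Fin n → Fin k) →
  does (dominated? x g σ) ≡ does (all? (λ j → g j ≤? x (suc (sizeBelow σ (toℕ (σ j))))))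
dominated?-sizeBelow x g σ =
  does-all?-cong _ _ (λ j → cong (λ z → g j ≤ᵇ x (suc z)) (sumBefore≡sizeBelow σ (σ j)))

dominated?-cong : ∀ x {n k} (g : Fin n → ℕ) {σ σ′ : Fin n → Fin k} → σ ≗ σ′ →
  does (dominated? x g σ) ≡ does (dominated? x g σ′)
dominated?-cong x g {σ} {σ′} σ≗σ′ =
  trans (dominated?-sizeBelow x g σ)
  (trans (does-all?-cong _ _ (λ j → cong (λ z → g j ≤ᵇ x (suc z)) (sizeBelow-cong j)))
         (sym (dominated?-sizeBelow x g σ′)))
  where
  sizeBelow-cong : ∀ j → sizeBelow σ (toℕ (σ j)) ≡ sizeBelow σ′ (toℕ (σ′ j))
  sizeBelow-cong j rewrite σ≗σ′ j = count-cong (λ j′ → cong (λ z → toℕ z <ᵇ toℕ (σ′ j)) (σ≗σ′ j′))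

partitionCount : (ℕ → ℕ) → ∀ {n} → (Fin n → ℕ) → ℕ → ℤ
partitionCount x {n} g k = ∑ᴹ {n} {k} (λ σ → ⟦surjective⟧ σ * ⟦dominated⟧ x g σ)

-1^ : ℕ → ℤ
-1^ e = (- + 1) ^ e

alternatingSum : (ℕ → ℕ) → ∀ n → (Fin n → ℕ) → ℤ
alternatingSum x n g = ∑[ k < n ] (-1^ (n ∸ suc (toℕ k)) * partitionCount x g (suc (toℕ k)))

rhsCoeff≡alternatingSum : ∀ x n (g : Fin n → ℕ) → rhsCoeff x n g ≡ alternatingSum x n g
rhsCoeff≡alternatingSum x n g = begin
  sumℤ (concatMap signedTerms (List.map suc (upTo n)))
    ≡⟨ sumℤ-concatMap signedTerms (List.map suc (upTo n)) ⟩
  sumℤ (List.map (sumℤ ∘ signedTerms) (List.map suc (upTo n)))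
    ≡⟨ cong sumℤ (sym (map-∘ (upTo n))) ⟩
  sumℤ (List.map (sumℤ ∘ signedTerms ∘ suc) (upTo n))
    ≡⟨ sumℤ-map-applyUpTo (sumℤ ∘ signedTerms ∘ suc) (λ k → k) n ⟩
  ∑[ k < n ] sumℤ (signedTerms (suc (toℕ k)))
    ≡⟨ ℤΣ.sum-cong-≗ {n} (λ k → sumℤ-signedTerms (suc (toℕ k))) ⟩
  alternatingSum x n g ∎
  where
  open ≡-Reasoning
  indicator : ∀ {k} → (Fin n → Fin k) → ℤ
  indicator σ = if does (dominated? x g σ) then + 1 else + 0
  signedTerms : ℕ → List ℤ
  signedTerms k = List.map (λ σ → -1^ (n ∸ k) * indicator σ) (OSP n k)
  sumℤ-signedTerms : ∀ k → sumℤ (signedTerms k) ≡ -1^ (n ∸ k) * partitionCount x g k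
  sumℤ-signedTerms k = begin
    sumℤ (signedTerms k)
      ≡⟨ sumℤ-map-filter surjective? (λ σ → -1^ (n ∸ k) * indicator σ) (allMaps n k) ⟩
    sumℤ (List.map summand (allMaps n k))
      ≡⟨ sumℤ-allMaps summand summand-ext ⟩
    ∑ᴹ summand
      ≡⟨ ∑ᴹ-cong rearrange ⟩
    ∑ᴹ (λ σ → -1^ (n ∸ k) * (⟦surjective⟧ σ * ⟦dominated⟧ x g σ))
      ≡⟨ *-distribˡ-∑ᴹ (-1^ (n ∸ k)) (λ σ → ⟦surjective⟧ σ * ⟦dominated⟧ x g σ) ⟨
    -1^ (n ∸ k) * partitionCount x g k ∎
    where
    summand : (Fin n → Fin k) → ℤ
    summand σ = ⟦surjective⟧ σ * (-1^ (n ∸ k) * indicator σ)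
    summand-ext : Extensional summand
    summand-ext σ≗σ′ = cong₂ (λ s d → ⟦ s ⟧ * (-1^ (n ∸ k) * (if d then + 1 else + 0)))
                             (surjective?-cong σ≗σ′) (dominated?-cong x g σ≗σ′)
    if≡⟦⟧ : ∀ b → (if b then + 1 else + 0) ≡ ⟦ b ⟧
    if≡⟦⟧ true = refl
    if≡⟦⟧ false = refl
    swap : ∀ (a s d : ℤ) → a * (s * d) ≡ s * (a * d)
    swap = solve-∀
    rearrange : ∀ σ → summand σ ≡ -1^ (n ∸ k) * (⟦surjective⟧ σ * ⟦dominated⟧ x g σ)
    rearrange σ = trans (cong (λ d → ⟦surjective⟧ σ * (-1^ (n ∸ k) * d)) (if≡⟦⟧ (does (dominated? x g σ))))
                        (swap (⟦surjective⟧ σ) (-1^ (n ∸ k)) (⟦dominated⟧ x g σ))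

-- Removing the first element

shift : ℕ → (ℕ → ℕ) → ℕ → ℕ
shift v x t = if v ≤ᵇ x t then x (suc t) else x t

shift-≤ : ∀ {v} x {t} → v ≤ x t → shift v x t ≡ x (suc t)
shift-≤ {v} x {t} v≤ = cong (λ b → if b then x (suc t) else x t) (dec-true (v ≤? x t) v≤)

shift-≰ : ∀ {v} x {t} → ¬ v ≤ x t → shift v x t ≡ x t
shift-≰ {v} x {t} v≰ = cong (λ b → if b then x (suc t) else x t) (dec-false (v ≤? x t) v≰)

shift-mono : ∀ {v x} → NonDecreasing₊ x → NonDecreasing₊ (shift v x)
shift-mono {v} {x} x-mono {a} {b} 1≤a a≤b with v ≤? x a | v ≤? x b
... | yes v≤xa | yes v≤xb rewrite shift-≤ x v≤xa | shift-≤ x v≤xb = x-mono (s≤s z≤n) (s≤s a≤b)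
... | yes v≤xa | no v≰xb = ⊥-elim (v≰xb (ℕ.≤-trans v≤xa (x-mono 1≤a a≤b)))
... | no v≰xa | yes v≤xb rewrite shift-≰ x v≰xa | shift-≤ x v≤xb = x-mono 1≤a (ℕ.m≤n⇒m≤1+n a≤b)
... | no v≰xa | no v≰xb rewrite shift-≰ x v≰xa | shift-≰ x v≰xb = x-mono 1≤a a≤b

shift≤x∘suc : ∀ {v x} → NonDecreasing₊ x → ∀ {t} → 1 ≤ t → shift v x t ≤ x (suc t)
shift≤x∘suc {v} {x} x-mono {t} 1≤t with v ≤? x t
... | yes v≤xt rewrite shift-≤ x v≤xt = ℕ.≤-refl
... | no v≰xt rewrite shift-≰ x v≰xt = x-mono 1≤t (ℕ.n≤1+n t)

-- Putting 0 into block t = toℕ i of σ = i ∷ ρ adds 1 to the prefix size of the elements of later blocks.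
-- headFits t is the condition g 0 ≤ p_σ 0, and tailFits t the condition on g ∘ suc when exactly the
-- elements of the blocks of τ numbered t or more get that extra 1 (t = i for ρ = punchIn i ∘ τ, and
-- t = i + 1 for ρ = τ).
module PlaceZero (x : ℕ → ℕ) (x-mono : NonDecreasing₊ x) {n k} (g : Fin (suc n) → ℕ) (τ : Fin n → Fin k) where

  v : ℕ
  v = g zero

  c : ℕ → ℕ
  c = sizeBelow τ

  headFits? : ∀ t → Dec (v ≤ x (suc (c t)))
  headFits? t = v ≤? x (suc (c t))

  headFits : ℕ → Bool
  headFits t = does (headFits? t)

  tailFits : ℕ → Bool
  tailFits t = does (all? (λ j → g (suc j) ≤? x (suc (𝟙 (t ≤ᵇ toℕ (τ j)) +ℕ c (toℕ (τ j))))))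

  dominated-∷-punchIn : ∀ i → does (dominated? x g (i ∷ punchIn i ∘ τ)) ≡ headFits (toℕ i) ∧ tailFits (toℕ i)
  dominated-∷-punchIn i =
    trans (dominated?-sizeBelow x g (i ∷ punchIn i ∘ τ))
          (cong₂ _∧_ (cong (λ z → v ≤ᵇ x (suc z)) below-i)
                     (does-all?-cong _ _ (λ j → cong (λ z → g (suc j) ≤ᵇ x (suc z)) (below-punchIn (τ j)))))
    where
    below-i : 𝟙 (toℕ i <ᵇ toℕ i) +ℕ sizeBelow (punchIn i ∘ τ) (toℕ i) ≡ c (toℕ i)
    below-i = cong₂ _+ℕ_ (cong 𝟙 (dec-false (toℕ i <? toℕ i) (ℕ.<-irrefl refl)))
                         (count-cong (λ j → punchIn<ᵇi i (τ j)))
    below-punchIn : ∀ b → 𝟙 (toℕ i <ᵇ toℕ (punchIn i b)) +ℕ sizeBelow (punchIn i ∘ τ) (toℕ (punchIn i b))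
                          ≡ 𝟙 (toℕ i ≤ᵇ toℕ b) +ℕ c (toℕ b)
    below-punchIn b = cong₂ _+ℕ_ (cong 𝟙 (i<ᵇpunchIn i b)) (count-cong (λ j → punchIn<ᵇpunchIn i (τ j) b))

  dominated-∷ : ∀ i → does (dominated? x g (i ∷ τ)) ≡ headFits (toℕ i) ∧ tailFits (suc (toℕ i))
  dominated-∷ i =
    trans (dominated?-sizeBelow x g (i ∷ τ))
          (cong (λ b → (v ≤ᵇ x (suc (𝟙 b +ℕ c (toℕ i)))) ∧ tailFits (suc (toℕ i)))
                (dec-false (toℕ i <? toℕ i) (ℕ.<-irrefl refl)))

  headFits-mono : ∀ {s t} → s ≤ t → v ≤ x (suc (c s)) → v ≤ x (suc (c t))
  headFits-mono s≤t v≤ = ℕ.≤-trans v≤ (x-mono (s≤s z≤n) (s≤s (sizeBelow-mono τ s≤t)))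

  tailFits-threshold : ∀ t → (∀ m → t ≤ m ⇔ (v ≤ x (suc (c m)))) →
    tailFits t ≡ does (dominated? (shift v x) (g ∘ suc) τ)
  tailFits-threshold t threshold =
    trans (does-all?-cong _ _ (λ j → cong (g (suc j) ≤ᵇ_) (capacity (toℕ (τ j)))))
          (sym (dominated?-sizeBelow (shift v x) (g ∘ suc) τ))
    where
    x-𝟙 : ∀ b y → x (suc (𝟙 b +ℕ y)) ≡ (if b then x (suc (suc y)) else x (suc y))
    x-𝟙 false y = refl
    x-𝟙 true y = refl
    capacity : ∀ m → x (suc (𝟙 (t ≤ᵇ m) +ℕ c m)) ≡ shift v x (suc (c m))
    capacity m = trans (cong (λ b → x (suc (𝟙 b +ℕ c m))) (does-⇔ (threshold m) (t ≤? m) (headFits? m)))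
                       (x-𝟙 (headFits m) (c m))

  placements-telescope : ∑[ i < suc k ] ⟦dominated⟧ x g (i ∷ punchIn i ∘ τ)
         ≡ ∑[ i < k ] ⟦dominated⟧ x g (i ∷ τ) + ⟦ v ≤ᵇ x (suc n) ⟧ * ⟦dominated⟧ (shift v x) (g ∘ suc) τ
  placements-telescope = begin
    ∑[ i < suc k ] ⟦dominated⟧ x g (i ∷ punchIn i ∘ τ)
      ≡⟨ ℤΣ.sum-cong-≗ {suc k} (cong ⟦_⟧ ∘ dominated-∷-punchIn) ⟩
    ∑[ i < suc k ] ⟦ headFits (toℕ i) ∧ tailFits (toℕ i) ⟧
      ≡⟨ telescope headFits tailFits target headFits-step tailFits-0 tailFits-jump k ⟩
    ∑[ i < k ] ⟦ headFits (toℕ i) ∧ tailFits (suc (toℕ i)) ⟧ + ⟦ headFits k ⟧ * ⟦ target ⟧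
      ≡⟨ cong₂ _+_ (ℤΣ.sum-cong-≗ {k} (cong ⟦_⟧ ∘ sym ∘ dominated-∷))
                   (cong (λ m → ⟦ v ≤ᵇ x (suc m) ⟧ * ⟦ target ⟧) c-k) ⟩
    ∑[ i < k ] ⟦dominated⟧ x g (i ∷ τ) + ⟦ v ≤ᵇ x (suc n) ⟧ * ⟦ target ⟧ ∎
    where
    open ≡-Reasoning
    target : Bool
    target = does (dominated? (shift v x) (g ∘ suc) τ)
    c-k : c k ≡ n
    c-k = count-all (λ j → ℕ.<⇒<ᵇ (Fin.toℕ<n (τ j)))
    headFits-step : ∀ t → T (headFits t) → T (headFits (suc t))
    headFits-step t = ℕ.≤⇒≤ᵇ ∘ headFits-mono (ℕ.n≤1+n t) ∘ ℕ.≤ᵇ⇒≤ _ _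
    tailFits-0 : T (headFits 0) → tailFits 0 ≡ target
    tailFits-0 fits₀ = tailFits-threshold 0 λ m →
      mk⇔ (λ _ → headFits-mono {t = m} z≤n (ℕ.≤ᵇ⇒≤ _ _ fits₀)) (λ _ → z≤n)
    tailFits-jump : ∀ t → ¬ T (headFits t) → T (headFits (suc t)) → tailFits (suc t) ≡ target
    tailFits-jump t ¬fitsₜ fitsₜ₊₁ = tailFits-threshold (suc t) λ m →
      mk⇔ (λ t<m → headFits-mono t<m (ℕ.≤ᵇ⇒≤ _ _ fitsₜ₊₁))
          (λ fitsₘ → ℕ.≰⇒> (λ m≤t → ¬fitsₜ (ℕ.≤⇒≤ᵇ (headFits-mono m≤t fitsₘ))))

-- Shared k and Singleton k count the partitions σ of [n + 1] into k + 1 blocks with g ≤ p_σ in which 0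
-- shares its block with other elements, resp. forms a block on its own.
module SplitAtZero (x : ℕ → ℕ) {n} (g : Fin (suc n) → ℕ) where

  fits : ∀ {k} → Fin k → (Fin n → Fin k) → ℤ
  fits i τ = ⟦dominated⟧ x g (i ∷ τ)

  Shared : ℕ → ℤ
  Shared k = ∑ᴹ {n} {suc k} (λ τ → ⟦surjective⟧ τ * ∑[ i < suc k ] fits i τ)

  Singleton : ℕ → ℤ
  Singleton k = ∑ᴹ {n} {k} (λ τ → ⟦surjective⟧ τ * ∑[ i < suc k ] fits i (punchIn i ∘ τ))

  partitionCount-split : ∀ k → partitionCount x g (suc k) ≡ Shared k + Singleton k
  partitionCount-split k = begin
    ∑[ i < suc k ] ∑ᴹ (λ τ → ⟦surjective⟧ (i ∷ τ) * fits i τ)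
      ≡⟨ ℤΣ.sum-cong-≗ {suc k} (λ i → trans (∑ᴹ-cong (split i)) (∑ᴹ-distrib-+ (shared i) (alone i))) ⟩
    ∑[ i < suc k ] (∑ᴹ (shared i) + ∑ᴹ (alone i))
      ≡⟨ ℤΣ.∑-distrib-+ (λ i → ∑ᴹ (shared i)) (λ i → ∑ᴹ (alone i)) ⟩
    ∑[ i < suc k ] ∑ᴹ (shared i) + ∑[ i < suc k ] ∑ᴹ (alone i)
      ≡⟨ cong₂ _+_ (trans (∑-∑ᴹ-comm shared) (∑ᴹ-cong (factor (λ i τ → fits i τ))))
                   (trans (ℤΣ.sum-cong-≗ {suc k} alone≡singleton)
                          (trans (∑-∑ᴹ-comm singleton) (∑ᴹ-cong (factor (λ i τ → fits i (punchIn i ∘ τ)))))) ⟩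
    Shared k + Singleton k ∎
    where
    open ≡-Reasoning
    shared alone : Fin (suc k) → (Fin n → Fin (suc k)) → ℤ
    shared i τ = ⟦surjective⟧ τ * fits i τ
    alone i τ = ⟦ does (avoids? i τ) ⟧ * (⟦surjective⟧ (i ∷ τ) * fits i τ)
    singleton : Fin (suc k) → (Fin n → Fin k) → ℤ
    singleton i τ = ⟦surjective⟧ τ * fits i (punchIn i ∘ τ)
    factor : ∀ {m} (h : Fin (suc k) → (Fin n → Fin m) → ℤ) τ →
      ∑[ i < suc k ] (⟦surjective⟧ τ * h i τ) ≡ ⟦surjective⟧ τ * ∑[ i < suc k ] h i τ
    factor h τ = sym (ℤΣ.*-distribˡ-sum (⟦surjective⟧ τ) (λ i → h i τ))
    split : ∀ i τ → ⟦surjective⟧ (i ∷ τ) * fits i τ ≡ shared i τ + alone i τ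
    split i τ = trans (cong (_* fits i τ) (surjective-∷-split i τ))
                      (distrib (⟦surjective⟧ τ) ⟦ does (avoids? i τ) ⟧ (⟦surjective⟧ (i ∷ τ)) (fits i τ))
      where
      distrib : ∀ (s a s′ c : ℤ) → (s + a * s′) * c ≡ s * c + a * (s′ * c)
      distrib = solve-∀
    alone≡singleton : ∀ i → ∑ᴹ (alone i) ≡ ∑ᴹ (singleton i)
    alone≡singleton i =
      trans (∑ᴹ-avoiding i (λ τ → ⟦surjective⟧ (i ∷ τ) * fits i τ)
                         (λ τ≗τ′ → cong₂ _*_ (cong ⟦_⟧ (surjective?-cong (∷-cong i τ≗τ′)))
                                             (cong ⟦_⟧ (dominated?-cong x g (∷-cong i τ≗τ′)))))
            (∑ᴹ-cong (λ τ → cong (λ s → ⟦ s ⟧ * fits i (punchIn i ∘ τ))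
                                 (does-⇔ surjective-∷-punchIn⇔ (surjective? (i ∷ punchIn i ∘ τ)) (surjective? τ))))

  Shared-n : Shared n ≡ + 0
  Shared-n = trans (∑ᴹ-cong (λ τ → cong (λ s → ⟦ s ⟧ * ∑[ i < suc n ] fits i τ)
                                        (dec-false (surjective? τ) (¬surjective-into-larger τ))))
                   (sym (*-distribˡ-∑ᴹ (+ 0) (λ τ → ∑[ i < suc n ] fits i τ)))

  Singleton-suc : NonDecreasing₊ x → ∀ k →
    Singleton (suc k) ≡ Shared k + ⟦ g zero ≤ᵇ x (suc n) ⟧ * partitionCount (shift (g zero) x) (g ∘ suc) (suc k)
  Singleton-suc x-mono k =
    trans (∑ᴹ-cong (λ τ → trans (cong (⟦surjective⟧ τ *_) (PlaceZero.placements-telescope x x-mono g τ))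
                                (distrib (⟦surjective⟧ τ) (∑[ i < suc k ] fits i τ) V (dominated′ τ))))
    (trans (∑ᴹ-distrib-+ (λ τ → ⟦surjective⟧ τ * ∑[ i < suc k ] fits i τ)
                         (λ τ → V * (⟦surjective⟧ τ * dominated′ τ)))
           (cong (_+_ (Shared k)) (sym (*-distribˡ-∑ᴹ V (λ τ → ⟦surjective⟧ τ * dominated′ τ)))))
    where
    V : ℤ
    V = ⟦ g zero ≤ᵇ x (suc n) ⟧
    dominated′ : (Fin n → Fin (suc k)) → ℤ
    dominated′ = ⟦dominated⟧ (shift (g zero) x) (g ∘ suc)
    distrib : ∀ (s a v d : ℤ) → s * (a + v * d) ≡ s * a + v * (s * d)
    distrib = solve-∀

alternatingSum-∷ : ∀ x → NonDecreasing₊ x → ∀ m (g : Fin (suc (suc m)) → ℕ) →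
  alternatingSum x (suc (suc m)) g
    ≡ ⟦ g zero ≤ᵇ x (suc (suc m)) ⟧ * alternatingSum (shift (g zero) x) (suc m) (g ∘ suc)
alternatingSum-∷ x x-mono m g = begin
  ∑[ k < suc n ] (-1^ (n ∸ toℕ k) * partitionCount x g (suc (toℕ k)))
    ≡⟨ ℤΣ.sum-cong-≗ {suc n} (λ k → trans (cong (-1^ (n ∸ toℕ k) *_) (partitionCount-split (toℕ k)))
                                          (ℤ.*-distribˡ-+ (-1^ (n ∸ toℕ k)) (Shared (toℕ k)) (Singleton (toℕ k)))) ⟩
  ∑[ k < suc n ] (shared (toℕ k) + singleton (toℕ k))
    ≡⟨ ℤΣ.∑-distrib-+ {suc n} (shared ∘ toℕ) (singleton ∘ toℕ) ⟩
  ∑[ k < suc n ] shared (toℕ k) + ∑[ k < suc n ] singleton (toℕ k)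
    ≡⟨ cong₂ _+_ drop-last drop-first ⟩
  ∑[ k < n ] shared (toℕ k) + ∑[ k < n ] singleton (suc (toℕ k))
    ≡⟨ ℤΣ.∑-distrib-+ {n} (shared ∘ toℕ) (singleton ∘ suc ∘ toℕ) ⟨
  ∑[ k < n ] (shared (toℕ k) + singleton (suc (toℕ k)))
    ≡⟨ ℤΣ.sum-cong-≗ {n} (λ k → cancel (toℕ k) (Fin.toℕ<n k)) ⟩
  ∑[ k < n ] (V * (-1^ (n ∸ suc (toℕ k)) * Q′ (suc (toℕ k))))
    ≡⟨ ℤΣ.*-distribˡ-sum {n} V (λ k → -1^ (n ∸ suc (toℕ k)) * Q′ (suc (toℕ k))) ⟨
  V * alternatingSum (shift (g zero) x) n (g ∘ suc) ∎
  where
  open ≡-Reasoning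
  open SplitAtZero x g
  n : ℕ
  n = suc m
  V : ℤ
  V = ⟦ g zero ≤ᵇ x (suc n) ⟧
  Q′ : ℕ → ℤ
  Q′ = partitionCount (shift (g zero) x) (g ∘ suc)
  shared singleton : ℕ → ℤ
  shared k = -1^ (n ∸ k) * Shared k
  singleton k = -1^ (n ∸ k) * Singleton k
  drop-last : ∑[ k < suc n ] shared (toℕ k) ≡ ∑[ k < n ] shared (toℕ k)
  drop-last = begin
    ∑[ k < suc n ] shared (toℕ k)       ≡⟨ ∑-toℕ-init-last n shared ⟩
    ∑[ k < n ] shared (toℕ k) + shared n ≡⟨ cong (_+_ (∑[ k < n ] shared (toℕ k))) shared-n ⟩
    ∑[ k < n ] shared (toℕ k) + + 0      ≡⟨ ℤ.+-identityʳ _ ⟩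
    ∑[ k < n ] shared (toℕ k)            ∎
    where
    shared-n : shared n ≡ + 0
    shared-n = trans (cong (-1^ (n ∸ n) *_) Shared-n) (ℤ.*-zeroʳ (-1^ (n ∸ n)))
  -- Singleton 0 sums over the maps Fin n → Fin 0 with n = suc m, so it reduces to 0.
  drop-first : ∑[ k < suc n ] singleton (toℕ k) ≡ ∑[ k < n ] singleton (suc (toℕ k))
  drop-first = trans (cong (_+ ∑[ k < n ] singleton (suc (toℕ k))) (ℤ.*-zeroʳ (-1^ n))) (ℤ.+-identityˡ _)
  cancel : ∀ k → k < n → shared k + singleton (suc k) ≡ V * (-1^ (n ∸ suc k) * Q′ (suc k))
  cancel k k<n =
    trans (cong₂ (λ s q → s * Shared k + -1^ (n ∸ suc k) * q) (cong -1^ (ℕ.+-∸-assoc 1 k<n)) (Singleton-suc x-mono k))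
          (ring (-1^ (n ∸ suc k)) (Shared k) V (Q′ (suc k)))
    where
    ring : ∀ (s a v q : ℤ) → (- + 1 * s) * a + s * (a + v * q) ≡ v * (s * q)
    ring = solve-∀

alternatingSum-one : ∀ x (g : Fin 1 → ℕ) → alternatingSum x 1 g ≡ ⟦ g zero ≤ᵇ x 1 ⟧
alternatingSum-one x g with g zero ≤ᵇ x 1
... | true = refl
... | false = refl

-- Parking functions

carsAtMost : ∀ {n} → (Fin n → ℕ) → ℕ → ℕ
carsAtMost f y = count (λ j → (1 ≤ᵇ f j) ∧ (f j ≤ᵇ y))

Parking : (ℕ → ℕ) → ∀ {n} → (Fin n → ℕ) → Set
Parking x {n} f = ∀ k → 1 ≤ k → k ≤ n → k ≤ carsAtMost f (x k)

IsParking⇔Parking : ∀ {x n} {f : Fin n → ℕ} → IsParking x f ⇔ Parking x f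
IsParking⇔Parking {x} {f = f} = mk⇔ (λ P k 1≤k k≤n → subst (k ≤_) (cars k) (P k 1≤k k≤n))
                                   (λ P k 1≤k k≤n → subst (k ≤_) (sym (cars k)) (P k 1≤k k≤n))
  where
  cars : ∀ k → #[ (λ j → (1 ≤? f j) ×-dec (f j ≤? x k)) ] ≡ carsAtMost f (x k)
  cars k = #[]≡count (λ j → (1 ≤? f j) ×-dec (f j ≤? x k))

carsAtMost-mono : ∀ {n} (f : Fin n → ℕ) {y y′} → y ≤ y′ → carsAtMost f y ≤ carsAtMost f y′
carsAtMost-mono f {y} {y′} y≤y′ =
  count-mono {f = λ j → (1 ≤ᵇ f j) ∧ (f j ≤ᵇ y)} {h = λ j → (1 ≤ᵇ f j) ∧ (f j ≤ᵇ y′)} λ j fj≤y →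
    let pos , fj≤ = Equivalence.to (T-∧ {1 ≤ᵇ f j}) fj≤y
    in Equivalence.from (T-∧ {1 ≤ᵇ f j}) (pos , ℕ.≤⇒≤ᵇ (ℕ.≤-trans (ℕ.≤ᵇ⇒≤ (f j) y fj≤) y≤y′))

carsAtMost-∷ : ∀ {n} {f : Fin (suc n) → ℕ} → Positive f → ∀ y →
  carsAtMost f y ≡ 𝟙 (f zero ≤ᵇ y) +ℕ carsAtMost (f ∘ suc) y
carsAtMost-∷ {f = f} f-pos y with 1 ≤ᵇ f zero | ℕ.≤⇒≤ᵇ (f-pos zero)
... | true | _ = refl

parking-∷ : ∀ {x n} {g : Fin (suc n) → ℕ} → NonDecreasing₊ x → Positive g →
  Parking x g ⇔ (g zero ≤ x (suc n) × Parking (shift (g zero) x) (g ∘ suc))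
parking-∷ {x} {n} {g} x-mono g-pos = mk⇔ to from
  where
  v : ℕ
  v = g zero
  cars : ℕ → ℕ
  cars = carsAtMost (g ∘ suc)
  first : ∀ {y} → v ≤ y → 𝟙 (v ≤ᵇ y) ≡ 1
  first {y} v≤y = cong 𝟙 (dec-true (v ≤? y) v≤y)
  ¬first : ∀ {y} → ¬ v ≤ y → 𝟙 (v ≤ᵇ y) ≡ 0
  ¬first {y} v≰y = cong 𝟙 (dec-false (v ≤? y) v≰y)

  to : Parking x g → g zero ≤ x (suc n) × Parking (shift v x) (g ∘ suc)
  to P = first-fits , rest-parks
    where
    P′ : ∀ k → 1 ≤ k → k ≤ suc n → k ≤ 𝟙 (v ≤ᵇ x k) +ℕ cars (x k)
    P′ k 1≤k k≤sn = subst (k ≤_) (carsAtMost-∷ g-pos (x k)) (P k 1≤k k≤sn)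
    first-fits : v ≤ x (suc n)
    first-fits with v ≤? x (suc n)
    ... | yes v≤ = v≤
    ... | no v≰ = ⊥-elim (ℕ.<-irrefl refl (ℕ.≤-trans too-many (count≤n _)))
      where
      too-many : suc n ≤ cars (x (suc n))
      too-many = subst (suc n ≤_) (cong (_+ℕ cars (x (suc n))) (¬first v≰)) (P′ (suc n) (s≤s z≤n) ℕ.≤-refl)
    rest-parks : Parking (shift v x) (g ∘ suc)
    rest-parks k 1≤k k≤n with v ≤? x k
    ... | yes v≤ rewrite shift-≤ x v≤ =
      ℕ.≤-pred (subst (suc k ≤_) (cong (_+ℕ cars (x (suc k))) (first (ℕ.≤-trans v≤ (x-mono 1≤k (ℕ.n≤1+n k)))))
                                 (P′ (suc k) (s≤s z≤n) (s≤s k≤n)))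
    ... | no v≰ rewrite shift-≰ x v≰ =
      subst (k ≤_) (cong (_+ℕ cars (x k)) (¬first v≰)) (P′ k 1≤k (ℕ.m≤n⇒m≤1+n k≤n))

  from : g zero ≤ x (suc n) × Parking (shift v x) (g ∘ suc) → Parking x g
  from (v≤ , P′) k 1≤k k≤sn = subst (k ≤_) (sym (carsAtMost-∷ g-pos (x k))) (go k 1≤k k≤sn)
    where
    go : ∀ k → 1 ≤ k → k ≤ suc n → k ≤ 𝟙 (v ≤ᵇ x k) +ℕ cars (x k)
    go k 1≤k k≤sn with v ≤? x k
    go (suc zero) _ _ | yes v≤xk rewrite first v≤xk = s≤s z≤n
    go (suc (suc k)) _ (s≤s k<n) | yes v≤xk rewrite first v≤xk =
      s≤s (ℕ.≤-trans (P′ (suc k) (s≤s z≤n) k<n) (carsAtMost-mono (g ∘ suc) (shift≤x∘suc {v} x-mono (s≤s z≤n))))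
    go k 1≤k k≤sn | no v≰xk rewrite ¬first v≰xk =
      subst (λ y → k ≤ cars y) (shift-≰ x v≰xk) (P′ k 1≤k (ℕ.≤-pred (ℕ.≤∧≢⇒< k≤sn λ { refl → v≰xk v≤ })))

Indicator : ∀ {ℓ} → Set ℓ → ℤ → Set ℓ
Indicator P z = (P → z ≡ + 1) × (¬ P → z ≡ + 0)

indicator-true : ∀ {ℓ} {P : Set ℓ} → P → Indicator P (+ 1)
indicator-true p = (λ _ → refl) , (λ ¬p → ⊥-elim (¬p p))

indicator-⇔ : ∀ {ℓ ℓ′} {P : Set ℓ} {Q : Set ℓ′} {z} → P ⇔ Q → Indicator Q z → Indicator P z
indicator-⇔ P⇔Q (Q⇒1 , ¬Q⇒0) = Q⇒1 ∘ Equivalence.to P⇔Q , λ ¬P → ¬Q⇒0 (¬P ∘ Equivalence.from P⇔Q)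

indicator-× : ∀ {ℓ ℓ′} {P : Set ℓ} {Q : Set ℓ′} {z} (P? : Dec P) → Indicator Q z →
  Indicator (P × Q) (⟦ does P? ⟧ * z)
indicator-× {z = z} (yes p) (Q⇒1 , ¬Q⇒0) =
  (λ (_ , q) → trans (ℤ.*-identityˡ z) (Q⇒1 q)) ,
  (λ ¬PQ → trans (ℤ.*-identityˡ z) (¬Q⇒0 (λ q → ¬PQ (p , q))))
indicator-× (no ¬p) _ = (λ (p , _) → ⊥-elim (¬p p)) , (λ _ → refl)

alternatingSum-indicates-parking : ∀ m x → NonDecreasing₊ x → (g : Fin (suc m) → ℕ) → Positive g →
  Indicator (Parking x g) (alternatingSum x (suc m) g)
alternatingSum-indicates-parking zero x x-mono g g-pos =
  subst (Indicator (Parking x g)) (trans (ℤ.*-identityʳ ⟦ g zero ≤ᵇ x 1 ⟧) (sym (alternatingSum-one x g)))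
        (indicator-⇔ (parking-∷ x-mono g-pos) (indicator-× (g zero ≤? x 1) (indicator-true λ { (suc _) _ () })))
alternatingSum-indicates-parking (suc m) x x-mono g g-pos =
  subst (Indicator (Parking x g)) (sym (alternatingSum-∷ x x-mono m g))
        (indicator-⇔ (parking-∷ x-mono g-pos) (indicator-× (g zero ≤? x (suc (suc m))) rest))
  where
  rest : Indicator (Parking (shift (g zero) x) (g ∘ suc)) (alternatingSum (shift (g zero) x) (suc m) (g ∘ suc))
  rest = alternatingSum-indicates-parking m (shift (g zero) x) (shift-mono {g zero} x-mono) (g ∘ suc) (g-pos ∘ suc)

theorem3 : (x : ℕ → ℕ) → NonDecreasing₊ x → (n : ℕ) → 1 ≤ n →
    (g : Fin n → ℕ) → Positive g →
      (IsParking x g → rhsCoeff x n g ≡ + 1) × (¬ IsParking x g → rhsCoeff x n g ≡ + 0)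
theorem3 x x-mono (suc m) _ g g-pos =
  subst (Indicator (IsParking x g)) (sym (rhsCoeff≡alternatingSum x (suc m) g))
        (indicator-⇔ (IsParking⇔Parking {x} {f = g}) (alternatingSum-indicates-parking m x x-mono g g-pos))
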